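{- For the problem of minimizing makespan for online job scheduling on $m \ge 2$ identical machines, $\textsc{Greedy}$ has online bounded ratio at least $2-\frac{1}{m-1}$.
   Context: Jobs with positive sizes arrive online and each must be assigned irrevocably (without preemption) to one of $m$ identical machines; the load of a machine is the total size of jobs assigned to it, and the makespan is the maximum load; the goal is to minimize the makespan. $\textsc{Greedy}$ assigns each job to a currently least loaded machine (ties arbitrary). For a deterministic online algorithm $A$ of a minimization problem, $\textsc{Opt}_A$ denotes an offline algorithm that is optimal among offline algorithms whose solution on any input $I$ satisfies, for every prefix $I'$ of $I$, that the cost of the solution restricted to $I'$ is at most $A(I')$. The online bounded ratio of $A$ is the infimum of all constants $c$ such that $A(I) \le c\,\textsc{Opt}_A(I)$ for all inputs $I$. -}

module Defs where

open import Data.Nat as ℕ using (ℕ; zero; suc)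
open import Data.Integer using (+_)
open import Data.Rational using (ℚ; 0ℚ; _+_; _-_; _*_; _/_; _⊔_; _≤_; _<_)
open import Data.Fin using (Fin; _≟_)
open import Data.List using (List; []; _∷_; _++_; [_]; map; take; allFin; foldr)
open import Data.List.Relation.Unary.All using (All)
open import Data.Product using (_×_; _,_; proj₁; proj₂; Σ; ∃)
open import Relation.Nullary using (yes; no)
open import Relation.Binary.PropositionalEquality using (_≡_)

-- A job sequence (input): list of job sizes.  Sizes must be positive.
Input : Set
Input = List ℚ

PositiveSizes : Input → Set
PositiveSizes I = All (λ p → 0ℚ < p) I

-- A schedule: each job (its size) paired with the machine it is assigned to,
-- in arrival order.
Schedule : ℕ → Set
Schedule m = List (ℚ × Fin m)

load : ∀ {m} → Schedule m → Fin m → ℚ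
load [] i = 0ℚ
load ((p , j) ∷ S) i with j ≟ i
... | yes _ = p + load S i
... | no  _ = load S i

-- Makespan: maximum load over all machines (loads are ≥ 0, so start at 0).
makespan : ∀ {m} → Schedule m → ℚ
makespan {m} S = foldr (λ i r → load S i ⊔ r) 0ℚ (allFin m)

-- A deterministic online algorithm: given the previous jobs (in order)
-- and the size of the current job, chooses a machine.
OnlineAlg : ℕ → Set
OnlineAlg m = List ℚ → ℚ → Fin m

runFrom : ∀ {m} → OnlineAlg m → List ℚ → Input → Schedule m
runFrom A h [] = []
runFrom A h (x ∷ xs) = (x , A h x) ∷ runFrom A (h ++ [ x ]) xs

run : ∀ {m} → OnlineAlg m → Input → Schedule m
run A I = runFrom A [] I

cost : ∀ {m} → OnlineAlg m → Input → ℚ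
cost A I = makespan (run A I)

-- Greedy (with an arbitrary deterministic tie-breaking): every job goes
-- to a currently least loaded machine.
IsGreedy : ∀ {m} → OnlineAlg m → Set
IsGreedy {m} A = ∀ (h : List ℚ) (x : ℚ) (i : Fin m) →
  load (run A h) (A h x) ≤ load (run A h) i

SolutionFor : ∀ {m} → Input → Schedule m → Set
SolutionFor I S = map proj₁ S ≡ I

AdmissibleFor : ∀ {m} → OnlineAlg m → Input → Schedule m → Set
AdmissibleFor A I S =
  SolutionFor I S × (∀ (k : ℕ) → makespan (take k S) ≤ cost A (take k I))

IsOptA : ∀ {m} → OnlineAlg m → Input → ℚ → Set
IsOptA {m} A I v =
  (Σ (Schedule m) λ S → AdmissibleFor A I S × makespan S ≡ v) ×
  (∀ (S : Schedule m) → AdmissibleFor A I S → v ≤ makespan S)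

-- The online bounded ratio of A is at least r: no constant c < r satisfies
-- A(I) ≤ c · Opt_A(I) for all inputs I.  (Constants range over ℚ; by density
-- this is equivalent to the real-valued infimum being ≥ r.)
BoundedRatioAtLeast : ∀ {m} → OnlineAlg m → ℚ → Set
BoundedRatioAtLeast {m} A r =
  ∀ (c : ℚ) → c < r →
    Σ Input λ I → PositiveSizes I ×
      Σ ℚ λ v → IsOptA A I v × (c * v < cost A I)

-- 2 - 1/(m-1), for m ≥ 2 (value irrelevant for m < 2).
bound : ℕ → ℚ
bound (suc (suc k)) = + 2 / 1 - + 1 / suc k
bound _ = 0ℚ

-- Write m = n + 2.  Given c < b, the Archimedean property gives a natural Q with
-- cQ + 1 < bQ.  On the input  Q, then N = nQ unit jobs, then Q :
--  * Opt_A = Q.  Every schedule has makespan ≥ Q (its first job), and the schedule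
--    putting the two big jobs alone on machines 0 and 1 and the unit jobs in n
--    blocks of Q on the other machines has all loads equal to Q; each of its
--    prefixes therefore costs ≤ Q, while any online algorithm already pays Q on
--    the first job.
--  * Greedy pays ≥ bQ − 1.  While the unit jobs arrive, every machine stays
--    1-balanced (at most 1 above every other machine), except the machine of the
--    first job as long as its load is ≤ Q.  Hence if the last job lands on a
--    machine of load L with L + 1 < Q, counting the total load gives
--    N ≤ (n + 1)(L + 1); in either case bQ ≤ L + Q + 1, and L + Q ≤ Greedy(I).
-- So Greedy(I) > cQ = c · Opt_A(I).
module Submission where

open import Defs
open import Data.Nat using (ℕ)

module Lists where
  open import Data.Nat using (zero; suc; _+_)
  open import Data.List using (replicate; _++_; [_]; _∷_)
  open import Relation.Binary.PropositionalEquality using (_≡_; refl; cong)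

  replicate-+ : ∀ {A : Set} a b (x : A) → replicate (a + b) x ≡ replicate a x ++ replicate b x
  replicate-+ zero b x = refl
  replicate-+ (suc a) b x = cong (x ∷_) (replicate-+ a b x)

  replicate-snoc : ∀ {A : Set} t (x : A) → replicate (suc t) x ≡ replicate t x ++ [ x ]
  replicate-snoc zero x = refl
  replicate-snoc (suc t) x = cong (x ∷_) (replicate-snoc t x)

module RationalFacts where
  open import Data.Nat as ℕ using (ℕ; zero; suc)
  import Data.Nat.Properties as ℕ
  open import Data.Nat.Coprimality using (1-coprimeTo) renaming (sym to coprime-sym)
  import Data.Integer as ℤ
  import Data.Integer.Properties as ℤ
  open import Data.Rational
  open import Data.Rational.Properties
  import Data.Rational.Unnormalised as ℚᵘ
  import Data.Rational.Unnormalised.Properties as ℚᵘ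
  open import Data.Rational.Solver using (module +-*-Solver)
  open import Algebra.Bundles using (CommutativeRing)
  open import Data.Product using (Σ; _,_; proj₁; proj₂)
  open import Function using (_∘_)
  open import Data.Fin using (Fin; zero; suc; punchIn)
  open import Data.Fin.Properties using (punchInᵢ≢i)
  open import Data.Vec.Functional using (removeAt)
  open import Algebra.Properties.CommutativeMonoid.Sum +-0-commutativeMonoid using (sum; sum-remove)
  open import Relation.Binary.PropositionalEquality
  open +-*-Solver

  open import Algebra.Properties.Semiring.Mult (CommutativeRing.semiring +-*-commutativeRing)
    using (_×_; ×1-homo-*)

  ι : ℕ → ℚ
  ι n = n × 1ℚ

  0<1 : 0ℚ < 1ℚ
  0<1 = positive⁻¹ 1ℚ

  0≤1 : 0ℚ ≤ 1ℚ
  0≤1 = <⇒≤ 0<1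

  ι-nonNeg : ∀ n → 0ℚ ≤ ι n
  ι-nonNeg zero = ≤-refl
  ι-nonNeg (suc n) = +-mono-≤ 0≤1 (ι-nonNeg n)

  ι-pos : ∀ n → 0ℚ < ι (suc n)
  ι-pos n = +-mono-<-≤ 0<1 (ι-nonNeg n)

  ι-* : ∀ a b → ι (a ℕ.* b) ≡ ι a * ι b
  ι-* = ×1-homo-*

  canonical : ℕ → ℚ
  canonical n = mkℚ (ℤ.+ n) 0 (coprime-sym (1-coprimeTo n))

  ι≡canonical : ∀ n → ι n ≡ canonical n
  ι≡canonical zero = refl
  ι≡canonical (suc n) = trans (cong (1ℚ +_) (ι≡canonical n)) one-plus
    where
    one-plus : 1ℚ + canonical n ≡ canonical (suc n)
    one-plus = toℚᵘ-injective (ℚᵘ.≃-trans (toℚᵘ-homo-+ 1ℚ (canonical n)) (ℚᵘ.*≡* eq))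
      where
      -- 1/1 + n/1 = (n + 1)/1, cross-multiplied
      eq : (ℤ.1ℤ ℤ.* ℤ.1ℤ ℤ.+ ℤ.+ n ℤ.* ℤ.1ℤ) ℤ.* ℤ.1ℤ ≡ (ℤ.1ℤ ℤ.+ ℤ.+ n) ℤ.* (ℤ.1ℤ ℤ.* ℤ.1ℤ)
      eq = trans (ℤ.*-identityʳ _) (trans (cong (ℤ._+_ ℤ.1ℤ) (ℤ.*-identityʳ (ℤ.+ n))) (sym (ℤ.*-identityʳ _)))

  archimedean : ∀ x → Σ ℕ λ q → x < ι (suc q)
  archimedean x@(mkℚ (ℤ.+ a) d _) = a , subst (x <_) (sym (ι≡canonical (suc a))) (*<* num<)
    where
    num< : ℤ.+ a ℤ.* ℤ.1ℤ ℤ.< ℤ.+ suc a ℤ.* ℤ.+ suc d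
    num< = subst₂ ℤ._<_ (ℤ.pos-* a 1) (ℤ.pos-* (suc a) (suc d))
             (ℤ.+<+ (subst (ℕ._< suc a ℕ.* suc d) (sym (ℕ.*-identityʳ a)) (ℕ.m≤m*n (suc a) (suc d))))
  archimedean x@(mkℚ ℤ.-[1+ a ] d _) = 0 , neg<pos x (ι 1)

  large-multiple : ∀ {c b} → c < b → Σ ℕ λ q → c * ι (suc q) + 1ℚ < b * ι (suc q)
  large-multiple {c} {b} c<b = q , (begin-strict
      c * Q + 1ℚ                  ≡⟨ cong (c * Q +_) (sym (*-inverseˡ ε)) ⟩
      c * Q + 1/ ε * ε            <⟨ +-monoʳ-< (c * Q) (*-monoˡ-<-pos ε 1/ε<Q) ⟩
      c * Q + Q * ε               ≡⟨ solve 3 (λ b c Q → c :* Q :+ Q :* (b :- c) := b :* Q) refl b c Q ⟩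
      b * Q                       ∎)
    where
    open ≤-Reasoning
    ε = b - c
    instance
      ε-pos : Positive ε
      ε-pos = positive (subst (_< ε) (+-inverseʳ c) (+-monoˡ-< (- c) c<b))
      ε-nonZero : NonZero ε
      ε-nonZero = pos⇒nonZero ε
    q = proj₁ (archimedean (1/ ε))
    Q = ι (suc q)
    1/ε<Q : 1/ ε < Q
    1/ε<Q = proj₂ (archimedean (1/ ε))

  +-cancelˡ-≤ : ∀ a {b c} → a + b ≤ a + c → b ≤ c
  +-cancelˡ-≤ a {b} {c} = subst₂ _≤_ (cancel b) (cancel c) ∘ +-monoʳ-≤ (- a)
    where
    cancel : ∀ x → - a + (a + x) ≡ x
    cancel x = solve 2 (λ a x → :- a :+ (a :+ x) := x) refl a x

  +-cancelʳ-< : ∀ a {b c} → b + a < c + a → b < c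
  +-cancelʳ-< a {b} {c} = subst₂ _<_ (cancel b) (cancel c) ∘ +-monoˡ-< (- a)
    where
    cancel : ∀ x → x + a - a ≡ x
    cancel x = solve 2 (λ a x → x :+ a :- a := x) refl a x

  p≤p+q : ∀ {p q} → 0ℚ ≤ q → p ≤ p + q
  p≤p+q {p} {q} 0≤q = subst (_≤ p + q) (+-identityʳ p) (+-monoʳ-≤ p 0≤q)

  sum-≤ : ∀ {r} (f : Fin r → ℚ) c → (∀ i → f i ≤ c) → sum f ≤ ι r * c
  sum-≤ {zero} f c _ = ≤-reflexive (sym (*-zeroˡ c))
  sum-≤ {suc r} f c f≤c = subst (sum f ≤_) (sym (distrib c (ι r)))
    (+-mono-≤ (f≤c zero) (sum-≤ (f ∘ suc) c (f≤c ∘ suc)))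
    where
    distrib : ∀ c a → (1ℚ + a) * c ≡ c + a * c
    distrib c a = solve 2 (λ c a → (con 1ℚ :+ a) :* c := c :+ a :* c) refl c a

  sum-≤-except : ∀ {r} (f : Fin (suc r) → ℚ) z c → (∀ i → i ≢ z → f i ≤ c) → sum f ≤ f z + ι r * c
  sum-≤-except f z c f≤c = subst (_≤ f z + _) (sym (sum-remove {i = z} f))
    (+-monoʳ-≤ (f z) (sum-≤ (removeAt f z) c (λ i → f≤c (punchIn z i) (punchInᵢ≢i z i))))

module Bound where
  open import Data.Nat using (suc)
  open import Data.Rational
  open import Data.Rational.Properties
  open import Data.Rational.Solver using (module +-*-Solver)
  open import Data.Sum using (_⊎_; inj₁; inj₂)
  open import Relation.Binary.PropositionalEquality
  open +-*-Solver
  open RationalFacts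

  -- For m = n + 2:  (m - 1) · (2 - 1/(m - 1)) = (m - 1) + (m - 2).  The literal
  -- 1/(n + 1) in bound is the normal form of the reciprocal of canonical (n + 1).
  bound-spec : ∀ n → ι (suc n) * bound (suc (suc n)) ≡ ι (suc n) + ι n
  bound-spec n = begin
      K * bound (suc (suc n))        ≡⟨ cong (λ y → K * ((1ℚ + 1ℚ) - y)) (↥p/↧p≡p (1/ c)) ⟩
      K * ((1ℚ + 1ℚ) - 1/ c)         ≡⟨ solve 2 (λ K y → K :* ((con 1ℚ :+ con 1ℚ) :- y) := K :+ K :- K :* y) refl K (1/ c) ⟩
      K + K - K * (1/ c)             ≡⟨ cong (λ y → K + K - y) (trans (cong (_* (1/ c)) (ι≡canonical (suc n))) (*-inverseʳ c)) ⟩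
      K + K - 1ℚ                     ≡⟨ solve 1 (λ a → (con 1ℚ :+ a) :+ (con 1ℚ :+ a) :- con 1ℚ := (con 1ℚ :+ a) :+ a) refl (ι n) ⟩
      K + ι n                        ∎
    where
    open ≡-Reasoning
    K = ι (suc n)
    c = canonical (suc n)

  -- Arithmetic core of the lower bound, with K = n + 1 and b = 2 - 1/K:
  -- if Q ≤ L + 1 or nQ ≤ K (L + 1), then bQ ≤ (L + Q) + 1.  Multiply by K, using
  -- Kb = K + n; the first case also uses n ≤ K.
  bound-estimate : ∀ n {Q L} → 0ℚ ≤ Q → Q ≤ L + 1ℚ ⊎ ι n * Q ≤ ι (suc n) * (L + 1ℚ) →
    bound (suc (suc n)) * Q ≤ (L + Q) + 1ℚ
  bound-estimate n {Q} {L} 0≤Q case = *-cancelˡ-≤-pos K (begin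
      K * (b * Q)       ≡⟨ trans (sym (*-assoc K b Q)) (cong (_* Q) (bound-spec n)) ⟩
      (K + ι n) * Q     ≤⟨ estimate case ⟩
      K * ((L + Q) + 1ℚ) ∎)
    where
    open ≤-Reasoning
    K = ι (suc n)
    b = bound (suc (suc n))
    instance
      K-pos : Positive K
      K-pos = positive (ι-pos n)
      K-nonNeg : NonNegative K
      K-nonNeg = pos⇒nonNeg K
      Q-nonNeg : NonNegative Q
      Q-nonNeg = nonNegative 0≤Q
    n≤K : ι n ≤ K
    n≤K = subst (_≤ K) (+-identityˡ (ι n)) (+-monoˡ-≤ (ι n) 0≤1)
    estimate : Q ≤ L + 1ℚ ⊎ ι n * Q ≤ K * (L + 1ℚ) → (K + ι n) * Q ≤ K * ((L + Q) + 1ℚ)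
    estimate (inj₁ Q≤L+1) = begin
      (K + ι n) * Q       ≤⟨ *-monoʳ-≤-nonNeg Q (+-monoʳ-≤ K n≤K) ⟩
      (K + K) * Q         ≡⟨ solve 2 (λ K Q → (K :+ K) :* Q := K :* (Q :+ Q)) refl K Q ⟩
      K * (Q + Q)         ≤⟨ *-monoˡ-≤-nonNeg K (+-monoʳ-≤ Q Q≤L+1) ⟩
      K * (Q + (L + 1ℚ))  ≡⟨ cong (K *_) (solve 2 (λ Q L → Q :+ (L :+ con 1ℚ) := (L :+ Q) :+ con 1ℚ) refl Q L) ⟩
      K * ((L + Q) + 1ℚ)  ∎
    estimate (inj₂ nQ≤K[L+1]) = begin
      (K + ι n) * Q        ≡⟨ *-distribʳ-+ Q K (ι n) ⟩
      K * Q + ι n * Q      ≤⟨ +-monoʳ-≤ (K * Q) nQ≤K[L+1] ⟩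
      K * Q + K * (L + 1ℚ) ≡⟨ solve 3 (λ K Q L → K :* Q :+ K :* (L :+ con 1ℚ) := K :* ((L :+ Q) :+ con 1ℚ)) refl K Q L ⟩
      K * ((L + Q) + 1ℚ)   ∎

module Schedules where
  open import Data.Nat using (ℕ; zero; suc)
  open import Data.Fin using (Fin; zero; suc; _≟_; punchIn)
  open import Data.Fin.Properties using (punchInᵢ≢i)
  open import Data.Rational using (ℚ; 0ℚ; _+_; _≤_; _⊔_)
  open import Data.Rational.Properties hiding (_≟_)
  open import Data.List using (List; []; _∷_; _++_; [_]; map; take; allFin; foldr)
  open import Data.List.Properties using (++-identityʳ; ++-assoc)
  open import Data.List.Relation.Unary.All using (All; []; _∷_)
  open import Data.List.Relation.Unary.Any using (here; there)
  open import Data.List.Membership.Propositional using (_∈_)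
  open import Data.List.Membership.Propositional.Properties using (∈-allFin)
  open import Data.Product using (_,_; proj₁; map₂)
  open import Data.Vec.Functional using (removeAt)
  open import Relation.Nullary using (yes; no; contradiction)
  open import Relation.Binary.PropositionalEquality hiding ([_])
  open import Algebra.Properties.CommutativeMonoid.Sum +-0-commutativeMonoid
    using (sum; sum-remove; sum-cong-≗; ∑-distrib-+; sum-replicate-zero)
  open RationalFacts using (p≤p+q)

  NonNegSizes : List ℚ → Set
  NonNegSizes = All (0ℚ ≤_)

  module _ {m : ℕ} where

    load-∷-self : ∀ x j (S : Schedule m) → load ((x , j) ∷ S) j ≡ x + load S j
    load-∷-self x j S with j ≟ j
    ... | yes _   = refl
    ... | no j≢j = contradiction refl j≢j

    load-∷-other : ∀ x {j i} (S : Schedule m) → j ≢ i → load ((x , j) ∷ S) i ≡ load S i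
    load-∷-other x {j} {i} S j≢i with j ≟ i
    ... | yes j≡i = contradiction j≡i j≢i
    ... | no _    = refl

    load-++ : ∀ (S T : Schedule m) i → load (S ++ T) i ≡ load S i + load T i
    load-++ [] T i = sym (+-identityˡ (load T i))
    load-++ ((x , j) ∷ S) T i with j ≟ i
    ... | yes _ = trans (cong (x +_) (load-++ S T i)) (sym (+-assoc x (load S i) (load T i)))
    ... | no _  = load-++ S T i

    load-nonNeg : ∀ (S : Schedule m) i → NonNegSizes (map proj₁ S) → 0ℚ ≤ load S i
    load-nonNeg [] i _ = ≤-refl
    load-nonNeg ((x , j) ∷ S) i (0≤x ∷ nn) with j ≟ i
    ... | yes _ = +-mono-≤ 0≤x (load-nonNeg S i nn)
    ... | no _  = load-nonNeg S i nn

    load-take : ∀ k (S : Schedule m) i → NonNegSizes (map proj₁ S) → load (take k S) i ≤ load S i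
    load-take zero S i nn = load-nonNeg S i nn
    load-take (suc k) [] i _ = ≤-refl
    load-take (suc k) ((x , j) ∷ S) i (_ ∷ nn) with j ≟ i
    ... | yes _ = +-monoʳ-≤ x (load-take k S i nn)
    ... | no _  = load-take k S i nn

    load-snoc-self : ∀ (S : Schedule m) x k → load (S ++ [ (x , k) ]) k ≡ load S k + x
    load-snoc-self S x k =
      trans (load-++ S _ k) (cong (load S k +_) (trans (load-∷-self x k []) (+-identityʳ x)))

    load-snoc-other : ∀ (S : Schedule m) x {k i} → k ≢ i → load (S ++ [ (x , k) ]) i ≡ load S i
    load-snoc-other S x {k} {i} k≢i =
      trans (load-++ S _ i) (trans (cong (load S i +_) (load-∷-other x [] k≢i)) (+-identityʳ (load S i)))

    load-snoc-grows : ∀ (S : Schedule m) {x} k i → 0ℚ ≤ x → load S i ≤ load (S ++ [ (x , k) ]) i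
    load-snoc-grows S {x} k i 0≤x =
      subst (load S i ≤_) (sym (load-++ S _ i)) (p≤p+q (load-nonNeg [ (x , k) ] i (0≤x ∷ [])))

    load≤makespan : ∀ (S : Schedule m) i → load S i ≤ makespan S
    load≤makespan S i = fold-upper (allFin m) (∈-allFin i)
      where
      fold-upper : ∀ {i} xs → i ∈ xs → load S i ≤ foldr (λ j r → load S j ⊔ r) 0ℚ xs
      fold-upper (_ ∷ _) (here refl) = p≤p⊔q _ _
      fold-upper (j ∷ xs) (there i∈xs) = p≤q⇒p≤r⊔q (load S j) (fold-upper xs i∈xs)

    makespan-least : ∀ (S : Schedule m) c → 0ℚ ≤ c → (∀ i → load S i ≤ c) → makespan S ≤ c
    makespan-least S c 0≤c load≤c = fold-least (allFin m)
      where
      fold-least : ∀ xs → foldr (λ j r → load S j ⊔ r) 0ℚ xs ≤ c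
      fold-least [] = 0≤c
      fold-least (j ∷ xs) = ⊔-lub (load≤c j) (fold-least xs)

    first-job≤makespan : ∀ x j (S : Schedule m) → NonNegSizes (map proj₁ S) → x ≤ makespan ((x , j) ∷ S)
    first-job≤makespan x j S nn = ≤-trans
      (subst (x ≤_) (sym (load-∷-self x j S)) (p≤p+q (load-nonNeg S j nn)))
      (load≤makespan ((x , j) ∷ S) j)

    sizes-runFrom : ∀ (A : OnlineAlg m) h xs → map proj₁ (runFrom A h xs) ≡ xs
    sizes-runFrom A h [] = refl
    sizes-runFrom A h (x ∷ xs) = cong (x ∷_) (sizes-runFrom A (h ++ [ x ]) xs)

    runFrom-snoc : ∀ (A : OnlineAlg m) h xs x →
      runFrom A h (xs ++ [ x ]) ≡ runFrom A h xs ++ [ (x , A (h ++ xs) x) ]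
    runFrom-snoc A h [] x = cong (λ h′ → [ (x , A h′ x) ]) (sym (++-identityʳ h))
    runFrom-snoc A h (y ∷ ys) x = cong ((y , A h y) ∷_) (trans (runFrom-snoc A (h ++ [ y ]) ys x)
      (cong (λ h′ → runFrom A (h ++ [ y ]) ys ++ [ (x , A h′ x) ]) (++-assoc h [ y ] ys)))

    run-snoc : ∀ (A : OnlineAlg m) xs x → run A (xs ++ [ x ]) ≡ run A xs ++ [ (x , A xs x) ]
    run-snoc A = runFrom-snoc A []

    last-job-cost : ∀ (A : OnlineAlg m) xs x → load (run A xs) (A xs x) + x ≤ cost A (xs ++ [ x ])
    last-job-cost A xs x = subst (_≤ cost A (xs ++ [ x ]))
      (trans (cong (λ S → load S k) (run-snoc A xs x)) (load-snoc-self (run A xs) x k))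
      (load≤makespan (run A (xs ++ [ x ])) k)
      where k = A xs x

  shift : ∀ {m} → Schedule m → Schedule (suc m)
  shift = map (map₂ suc)

  load-shift-zero : ∀ {m} (S : Schedule m) → load (shift S) zero ≡ 0ℚ
  load-shift-zero [] = refl
  load-shift-zero (_ ∷ S) = load-shift-zero S

  load-shift-suc : ∀ {m} (S : Schedule m) i → load (shift S) (suc i) ≡ load S i
  load-shift-suc [] i = refl
  load-shift-suc ((x , j) ∷ S) i with j ≟ i
  ... | yes _ = cong (x +_) (load-shift-suc S i)
  ... | no _  = load-shift-suc S i

  sizes-shift : ∀ {m} (S : Schedule m) → map proj₁ (shift S) ≡ map proj₁ S
  sizes-shift [] = refl
  sizes-shift ((x , _) ∷ S) = cong (x ∷_) (sizes-shift S)

  sum-load-single : ∀ {r} x (k : Fin (suc r)) → sum (load [ (x , k) ]) ≡ x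
  sum-load-single {r} x k = begin
    sum (load [ (x , k) ])                                   ≡⟨ sum-remove {i = k} (load [ (x , k) ]) ⟩
    load [ (x , k) ] k + sum (removeAt (load [ (x , k) ]) k) ≡⟨ cong₂ _+_ at-k (trans (sum-cong-≗ elsewhere) (sum-replicate-zero r)) ⟩
    x + 0ℚ                                                   ≡⟨ +-identityʳ x ⟩
    x                                                        ∎
    where
    open ≡-Reasoning
    at-k : load [ (x , k) ] k ≡ x
    at-k = trans (load-∷-self x k []) (+-identityʳ x)
    elsewhere : ∀ i → load [ (x , k) ] (punchIn k i) ≡ 0ℚ
    elsewhere i = load-∷-other x [] (λ k≡ → punchInᵢ≢i k i (sym k≡))

  sum-load-snoc : ∀ {r} (S : Schedule (suc r)) x k → sum (load (S ++ [ (x , k) ])) ≡ sum (load S) + x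
  sum-load-snoc S x k = begin
    sum (load (S ++ [ (x , k) ]))              ≡⟨ sum-cong-≗ (load-++ S _) ⟩
    sum (λ i → load S i + load [ (x , k) ] i)  ≡⟨ ∑-distrib-+ (load S) (load [ (x , k) ]) ⟩
    sum (load S) + sum (load [ (x , k) ])      ≡⟨ cong (sum (load S) +_) (sum-load-single x k) ⟩
    sum (load S) + x                           ∎
    where open ≡-Reasoning

module Greedy where
  open import Data.Nat using (ℕ; zero; suc)
  open import Data.Fin using (Fin; _≟_)
  open import Data.Rational using (ℚ; 0ℚ; 1ℚ; _+_; _*_; _≤_; _≤?_)
  open import Data.Rational.Properties hiding (_≟_)
  open import Data.List using (_∷_; []; _++_; [_]; replicate)
  open import Data.List.Relation.Unary.All using (_∷_; [])
  open import Data.Product using (_×_; _,_)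
  open import Data.Sum using (_⊎_; inj₁; inj₂)
  open import Function using (_∘_)
  open import Relation.Nullary using (yes; no; contradiction)
  open import Relation.Binary.PropositionalEquality hiding ([_])
  open import Algebra.Properties.CommutativeMonoid.Sum +-0-commutativeMonoid using (sum)
  open import Data.Rational.Solver using (module +-*-Solver)
  open +-*-Solver using (solve; _:+_; _:=_; con)
  open RationalFacts
  open Schedules
  open Lists

  Balanced : ∀ {m} → ℚ → (Fin m → ℚ) → Fin m → Set
  Balanced p f i = ∀ j → f i ≤ f j + p

  LeastLoaded : ∀ {m} → Schedule m → Fin m → Set
  LeastLoaded S k = ∀ j → load S k ≤ load S j

  balanced-step : ∀ {m} (S : Schedule m) p k → 0ℚ ≤ p → LeastLoaded S k →
    ∀ i → i ≡ k ⊎ Balanced p (load S) i → Balanced p (load (S ++ [ (p , k) ])) i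
  balanced-step S p k 0≤p least i k-or-balanced j with k ≟ i
  ... | yes refl = begin
    load S′ k      ≡⟨ load-snoc-self S p k ⟩
    load S k + p   ≤⟨ +-monoˡ-≤ p (least j) ⟩
    load S j + p   ≤⟨ +-monoˡ-≤ p (load-snoc-grows S k j 0≤p) ⟩
    load S′ j + p  ∎
    where
    open ≤-Reasoning
    S′ = S ++ [ (p , k) ]
  ... | no k≢i = begin
    load S′ i      ≡⟨ load-snoc-other S p k≢i ⟩
    load S i       ≤⟨ balanced k-or-balanced j ⟩
    load S j + p   ≤⟨ +-monoˡ-≤ p (load-snoc-grows S k j 0≤p) ⟩
    load S′ j + p  ∎
    where
    open ≤-Reasoning
    S′ = S ++ [ (p , k) ]
    balanced : i ≡ k ⊎ Balanced p (load S) i → Balanced p (load S) i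
    balanced (inj₁ i≡k) = contradiction (sym i≡k) k≢i
    balanced (inj₂ bal) = bal

  module Phase {r : ℕ} (A : OnlineAlg (suc r)) (greedy : IsGreedy A) (Q : ℚ) (0≤Q : 0ℚ ≤ Q) where

    jobs : ℕ → Input
    jobs t = Q ∷ replicate t 1ℚ

    loads : ℕ → Fin (suc r) → ℚ
    loads t = load (run A (jobs t))

    big : Fin (suc r)
    big = A [] Q

    Invariant : (Fin (suc r) → ℚ) → Set
    Invariant f = ∀ i → Balanced 1ℚ f i ⊎ (i ≡ big × f i ≤ Q)

    run-jobs-suc : ∀ t → run A (jobs (suc t)) ≡ run A (jobs t) ++ [ (1ℚ , A (jobs t) 1ℚ) ]
    run-jobs-suc t = trans (cong (run A ∘ (Q ∷_)) (replicate-snoc t 1ℚ)) (run-snoc A (jobs t) 1ℚ)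

    invariant-step : ∀ S k → LeastLoaded S k → Invariant (load S) → Invariant (load (S ++ [ (1ℚ , k) ]))
    invariant-step S k least inv i with inv i
    ... | inj₁ bal = inj₁ (balanced-step S 1ℚ k 0≤1 least i (inj₂ bal))
    ... | inj₂ (refl , big≤Q) with k ≟ big
    ...   | yes refl  = inj₁ (balanced-step S 1ℚ k 0≤1 least i (inj₁ refl))
    ...   | no k≢big = inj₂ (refl , subst (_≤ Q) (sym (load-snoc-other S 1ℚ k≢big)) big≤Q)

    -- Initially only the big machine is loaded, and it carries exactly Q.
    invariant : ∀ t → Invariant (loads t)
    invariant zero i with big ≟ i
    ... | yes refl = inj₂ (refl , ≤-reflexive (+-identityʳ Q))
    ... | no _     = inj₁ λ j → ≤-trans (load-nonNeg (run A (jobs zero)) j (0≤Q ∷ [])) (p≤p+q 0≤1)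
    invariant (suc t) = subst Invariant (sym (cong load (run-jobs-suc t)))
      (invariant-step (run A (jobs t)) (A (jobs t) 1ℚ) (greedy (jobs t) 1ℚ) (invariant t))

    total : ∀ t → sum (loads t) ≡ Q + ι t
    total zero = trans (sum-load-single Q big) (sym (+-identityʳ Q))
    total (suc t) = begin
      sum (loads (suc t))                                      ≡⟨ cong (sum ∘ load) (run-jobs-suc t) ⟩
      sum (load (run A (jobs t) ++ [ (1ℚ , A (jobs t) 1ℚ) ])) ≡⟨ sum-load-snoc (run A (jobs t)) 1ℚ _ ⟩
      sum (loads t) + 1ℚ                                       ≡⟨ cong (_+ 1ℚ) (total t) ⟩
      Q + ι t + 1ℚ                                             ≡⟨ solve 2 (λ Q x → Q :+ x :+ con 1ℚ := Q :+ (con 1ℚ :+ x)) refl Q (ι t) ⟩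
      Q + ι (suc t)                                            ∎
      where open ≡-Reasoning

    -- Key estimate: if a machine k has load L with L + 1 < Q, then the big machine
    -- carries at most Q and the r others at most L + 1; comparing with the total
    -- load Q + t gives t ≤ r (L + 1).
    machine-load-bound : ∀ t k → Q ≤ loads t k + 1ℚ ⊎ ι t ≤ ι r * (loads t k + 1ℚ)
    machine-load-bound t k with Q ≤? loads t k + 1ℚ
    ... | yes Q≤L+1 = inj₁ Q≤L+1
    ... | no Q≰L+1 = inj₂ (+-cancelˡ-≤ Q (begin
      Q + ι t                     ≡⟨ sym (total t) ⟩
      sum (loads t)               ≤⟨ sum-≤-except (loads t) big (L + 1ℚ) others≤ ⟩
      loads t big + ι r * (L + 1ℚ) ≤⟨ +-monoˡ-≤ (ι r * (L + 1ℚ)) big≤Q ⟩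
      Q + ι r * (L + 1ℚ)          ∎))
      where
      open ≤-Reasoning
      L = loads t k
      others≤ : ∀ i → i ≢ big → loads t i ≤ L + 1ℚ
      others≤ i i≢big with invariant t i
      ... | inj₁ bal = bal k
      ... | inj₂ (i≡big , _) = contradiction i≡big i≢big
      big≤Q : loads t big ≤ Q
      big≤Q with invariant t big
      ... | inj₁ bal = ≤-trans (bal k) (<⇒≤ (≰⇒> Q≰L+1))
      ... | inj₂ (_ , big≤Q) = big≤Q

module WorstCase (n q : ℕ) where
  open import Data.Nat as ℕ using (ℕ; zero; suc)
  open import Data.Fin using (Fin; zero; suc)
  open import Data.Rational using (ℚ; 0ℚ; 1ℚ; _+_; _*_; _≤_; _<_)
  open import Data.Rational.Properties
  open import Data.List using ([]; _∷_; _++_; [_]; map; take; replicate)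
  open import Data.List.Properties using (map-++; map-replicate; ∷-injectiveˡ; ∷-injectiveʳ)
  open import Data.List.Relation.Unary.All using (_∷_; [])
  import Data.List.Relation.Unary.All as All
  open import Data.List.Relation.Unary.All.Properties using (++⁺; replicate⁺; take⁺)
  open import Data.Product using (_,_; proj₁)
  open import Data.Sum using (_⊎_)
  open import Function using (_∘_)
  open import Relation.Binary.PropositionalEquality hiding ([_])
  open RationalFacts
  open Bound
  open Schedules
  open Lists

  m : ℕ
  m = suc (suc n)

  Q : ℚ
  Q = ι (suc q)

  N : ℕ
  N = n ℕ.* suc q

  input : Input
  input = (Q ∷ replicate N 1ℚ) ++ [ Q ]

  0<Q : 0ℚ < Q
  0<Q = ι-pos q

  input-positive : PositiveSizes input
  input-positive = 0<Q ∷ ++⁺ (replicate⁺ N 0<1) (0<Q ∷ [])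

  units : ∀ {k} → Schedule (suc k)
  units = replicate (suc q) (1ℚ , zero)

  blocks : ∀ r → Schedule r
  blocks zero = []
  blocks (suc r) = units ++ shift (blocks r)

  load-units-zero : ∀ {k} c → load (replicate c (1ℚ , zero {k})) zero ≡ ι c
  load-units-zero zero = refl
  load-units-zero (suc c) = cong (1ℚ +_) (load-units-zero c)

  load-units-suc : ∀ {k} c (i : Fin k) → load (replicate c (1ℚ , zero)) (suc i) ≡ 0ℚ
  load-units-suc zero i = refl
  load-units-suc (suc c) i = load-units-suc c i

  load-blocks : ∀ r i → load (blocks r) i ≡ Q
  load-blocks (suc r) zero = begin
    load (units ++ shift (blocks r)) zero          ≡⟨ load-++ units _ zero ⟩
    load units zero + load (shift (blocks r)) zero ≡⟨ cong₂ _+_ (load-units-zero (suc q)) (load-shift-zero (blocks r)) ⟩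
    Q + 0ℚ                                         ≡⟨ +-identityʳ Q ⟩
    Q                                              ∎
    where open ≡-Reasoning
  load-blocks (suc r) (suc i) = begin
    load (units ++ shift (blocks r)) (suc i)               ≡⟨ load-++ units _ (suc i) ⟩
    load units (suc i) + load (shift (blocks r)) (suc i)   ≡⟨ cong₂ _+_ (load-units-suc (suc q) i) (trans (load-shift-suc (blocks r) i) (load-blocks r i)) ⟩
    0ℚ + Q                                                 ≡⟨ +-identityˡ Q ⟩
    Q                                                      ∎
    where open ≡-Reasoning

  sizes-blocks : ∀ r → map proj₁ (blocks r) ≡ replicate (r ℕ.* suc q) 1ℚ
  sizes-blocks zero = refl
  sizes-blocks (suc r) = begin
    map proj₁ (units ++ shift (blocks r))                   ≡⟨ map-++ proj₁ units (shift (blocks r)) ⟩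
    map proj₁ units ++ map proj₁ (shift (blocks r))         ≡⟨ cong₂ _++_ (map-replicate proj₁ (suc q) _) (trans (sizes-shift (blocks r)) (sizes-blocks r)) ⟩
    replicate (suc q) 1ℚ ++ replicate (r ℕ.* suc q) 1ℚ      ≡⟨ replicate-+ (suc q) (r ℕ.* suc q) 1ℚ ⟨
    replicate (suc r ℕ.* suc q) 1ℚ                          ∎
    where open ≡-Reasoning

  middle : Schedule m
  middle = shift (shift (blocks n))

  optimal : Schedule m
  optimal = (Q , zero) ∷ (middle ++ [ (Q , suc zero) ])

  sizes-optimal : map proj₁ optimal ≡ input
  sizes-optimal = cong (Q ∷_) (trans (map-++ proj₁ middle _)
    (cong (_++ [ Q ]) (trans (sizes-shift _) (trans (sizes-shift _) (sizes-blocks n)))))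

  load-optimal : ∀ i → load optimal i ≡ Q
  load-optimal zero = begin
    load optimal zero                             ≡⟨⟩
    Q + load (middle ++ [ (Q , suc zero) ]) zero  ≡⟨ cong (Q +_) (trans (load-snoc-other middle Q (λ ())) (load-shift-zero (shift (blocks n)))) ⟩
    Q + 0ℚ                                        ≡⟨ +-identityʳ Q ⟩
    Q                                             ∎
    where open ≡-Reasoning
  load-optimal (suc zero) = begin
    load optimal (suc zero)                        ≡⟨⟩
    load (middle ++ [ (Q , suc zero) ]) (suc zero) ≡⟨ load-snoc-self middle Q (suc zero) ⟩
    load middle (suc zero) + Q                     ≡⟨ cong (_+ Q) (trans (load-shift-suc (shift (blocks n)) zero) (load-shift-zero (blocks n))) ⟩
    0ℚ + Q                                         ≡⟨ +-identityˡ Q ⟩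
    Q                                              ∎
    where open ≡-Reasoning
  load-optimal (suc (suc i)) = begin
    load optimal (suc (suc i))                        ≡⟨⟩
    load (middle ++ [ (Q , suc zero) ]) (suc (suc i)) ≡⟨ load-snoc-other middle Q (λ ()) ⟩
    load middle (suc (suc i))                         ≡⟨ trans (load-shift-suc (shift (blocks n)) (suc i)) (load-shift-suc (blocks n) i) ⟩
    load (blocks n) i                                 ≡⟨ load-blocks n i ⟩
    Q                                                 ∎
    where open ≡-Reasoning

  input-nonNeg : NonNegSizes input
  input-nonNeg = All.map <⇒≤ input-positive

  solution-lower : ∀ (S : Schedule m) → SolutionFor input S → Q ≤ makespan S
  solution-lower [] ()
  solution-lower ((x , j) ∷ S) sizes = subst (_≤ makespan ((x , j) ∷ S)) (∷-injectiveˡ sizes)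
    (first-job≤makespan x j S (subst NonNegSizes (sym (∷-injectiveʳ sizes)) (All.tail input-nonNeg)))

  makespan-optimal : makespan optimal ≡ Q
  makespan-optimal = ≤-antisym (makespan-least optimal Q (<⇒≤ 0<Q) (≤-reflexive ∘ load-optimal))
                               (solution-lower optimal sizes-optimal)

  module _ (A : OnlineAlg m) where

    -- Every nonempty prefix of the input starts with the big job, so A pays at least Q on it.
    prefix-cost : ∀ k → Q ≤ cost A (take (suc k) input)
    prefix-cost k = first-job≤makespan Q (A [] Q) _
      (subst NonNegSizes (sym (sizes-runFrom A _ _)) (take⁺ k (All.tail input-nonNeg)))

    -- Each prefix of the block schedule costs at most Q, which A already pays.
    admissible : AdmissibleFor A input optimal
    admissible = sizes-optimal , prefix-bound
      where
      prefix-bound : ∀ k → makespan (take k optimal) ≤ cost A (take k input)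
      prefix-bound zero = ≤-refl
      prefix-bound (suc k) =
        ≤-trans (makespan-least (take (suc k) optimal) Q (<⇒≤ 0<Q) prefix-load) (prefix-cost k)
        where
        prefix-load : ∀ i → load (take (suc k) optimal) i ≤ Q
        prefix-load i = ≤-trans (load-take (suc k) optimal i (subst NonNegSizes (sym sizes-optimal) input-nonNeg))
                                (≤-reflexive (load-optimal i))

    opt-value : IsOptA A input Q
    opt-value = (optimal , admissible , makespan-optimal) , λ S adm → solution-lower S (proj₁ adm)

    greedy-cost : IsGreedy A → bound m * Q ≤ cost A input + 1ℚ
    greedy-cost greedy = begin
      bound m * Q       ≤⟨ bound-estimate n {Q} {L} (<⇒≤ 0<Q) balance ⟩
      (L + Q) + 1ℚ      ≤⟨ +-monoˡ-≤ 1ℚ (last-job-cost A (jobs N) Q) ⟩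
      cost A input + 1ℚ ∎
      where
      open ≤-Reasoning
      open Greedy.Phase A greedy Q (<⇒≤ 0<Q)
      k = A (jobs N) Q
      L = loads N k
      balance : Q ≤ L + 1ℚ ⊎ ι n * Q ≤ ι (suc n) * (L + 1ℚ)
      balance = subst (λ x → Q ≤ L + 1ℚ ⊎ x ≤ ι (suc n) * (L + 1ℚ)) (ι-* n (suc q)) (machine-load-bound N k)

    greedy-exceeds : IsGreedy A → ∀ c → c * Q + 1ℚ < bound m * Q → c * Q < cost A input
    greedy-exceeds greedy c gap = +-cancelʳ-< 1ℚ (<-≤-trans gap (greedy-cost greedy))

open import Data.Nat using (ℕ; suc; _≤_; s≤s)
open import Data.Product using (_,_; proj₁; proj₂)
open RationalFacts using (large-multiple)

lemma2 : (m : ℕ) → 2 ≤ m → (A : OnlineAlg m) → IsGreedy A →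
    BoundedRatioAtLeast A (bound m)
lemma2 (suc (suc n)) (s≤s (s≤s _)) A greedy c c<b =
  input , input-positive , Q , opt-value A , greedy-exceeds A greedy c gap
  where
  open WorstCase n (proj₁ (large-multiple c<b))
  gap = proj₂ (large-multiple c<b)
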